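{- Let $I\subseteq[1..n]$ and $f_l,f_u: I\to\mathbb{N}$ be such that for all $i\in I$: (i) $f_l(i)=1$ or $L_i/(f_l(i)-1)$ is infeasible, and (ii) $L_i/f_u(i)$ is feasible; and for all $i'\in[1..n]\setminus I$: (iii) $L_{i'}$ is feasible but not optimal (i.e. $L_{i'}\ne l^\star$). Then $l^\star\in\mathbf{C}(I,f_l,f_u)$.
   Context: Let $\mathbf{L}=\{L_1,\dots,L_n\}$ be a multiset of positive rationals and $k\in\mathbb{N}_{>0}$. For $l\in\mathbb{Q}_{>0}$ let $m(l)=\sum_{i=1}^n\lfloor L_i/l\rfloor$; $l$ is feasible if $m(l)\ge k$ and infeasible otherwise. The optimal cut length is $l^\star=\max\{l\in\mathbb{Q}_{>0}\mid m(l)\ge k\}$. For $I\subseteq[1..n]$ and functions $f_l: I\to\mathbb{N}$, $f_u: I\to\mathbb{N}\cup\{\infty\}$, the candidate multiset is $\mathbf{C}(I,f_l,f_u)=\biguplus_{i\in I}\{L_i/j\mid f_l(i)\le j\le f_u(i)\}$ (multiset union). -}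

module Defs where

open import Data.Nat using (ℕ; zero; suc; _≤_)
open import Data.Integer as ℤ using (ℤ; +_; +[1+_]; -[1+_])
open import Data.Rational as ℚ using (ℚ; mkℚ; 0ℚ; _÷_; floor; _/_; Positive)
open import Data.Fin using (Fin)
open import Data.Fin.Subset using (Subset; _∈_; _∉_)
open import Data.Product using (Σ; _×_; ∃-syntax)
open import Relation.Binary.PropositionalEquality using (_≡_)
open import Relation.Nullary using (¬_)

-- Division of rationals, total by the junk convention p /? 0 = 0.
-- (Only ever used with positive divisors below.)
_/?_ : ℚ → ℚ → ℚ
p /? mkℚ (+ zero) _ _ = 0ℚ
p /? q@(mkℚ +[1+ _ ] _ _) = p ÷ q
p /? q@(mkℚ -[1+ _ ] _ _) = p ÷ q

_/ℕ_ : ℚ → ℕ → ℚ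
p /ℕ j = p /? (+ j / 1)

Σℤ : (n : ℕ) → (Fin n → ℤ) → ℤ
Σℤ zero f = + 0
Σℤ (suc n) f = f Fin.zero ℤ.+ Σℤ n (λ i → f (Fin.suc i))
  where import Data.Fin as Fin

m : {n : ℕ} → (Fin n → ℚ) → ℚ → ℤ
m {n} L l = Σℤ n (λ i → floor (L i /? l))

Feasible : {n : ℕ} → (Fin n → ℚ) → ℕ → ℚ → Set
Feasible L k l = Positive l × (+ k ℤ.≤ m L l)

IsOptimal : {n : ℕ} → (Fin n → ℚ) → ℕ → ℚ → Set
IsOptimal L k l = Feasible L k l × (∀ l' → Feasible L k l' → l' ℚ.≤ l)

InCandidates : {n : ℕ} → (Fin n → ℚ) → Subset n → (Fin n → ℕ) → (Fin n → ℕ) → ℚ → Set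
InCandidates L I fl fu x =
  ∃[ i ] ∃[ j ] (i ∈ I × fl i ≤ j × j ≤ fu i × x ≡ L i /ℕ j)

-- Let j_i = ⌊L_i / l*⌋.  The breakpoint of L_i at l* is the largest l with ⌊L_i / l⌋ ≥ j_i,
-- namely L_i / j_i (or anything above l* when j_i = 0); it is ≥ l*.  At the smallest
-- breakpoint l' every count ⌊L_i / l'⌋ is still ≥ j_i, so l' is feasible, hence l' = l* by
-- optimality: l* = L_i / j for some i and some j ≥ 1.  If i ∉ I then L_i is feasible, so
-- L_i ≤ l* = L_i / j ≤ L_i, contradicting L_i ≠ l*.  If i ∈ I, then L_i / f_u(i) ≤ l* gives
-- j ≤ f_u(i), and j < f_l(i) would make L_i / (f_l(i) − 1) ≤ l* feasible.
module Submission where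

open import Defs
open import Data.Nat as ℕ using (ℕ; zero; suc; _≤_; _∸_; s≤s; z≤n)
import Data.Nat.Properties as ℕP
open import Data.Integer as ℤ using (ℤ; +_; +0; +[1+_]; -[1+_])
import Data.Integer.Properties as ℤP
open import Data.Integer.DivMod using ([n/d]*d≤n; n<s[n/ℕd]*d; div-pos-is-/ℕ)
open import Data.Rational as ℚ using (ℚ; mkℚ; 0ℚ; 1ℚ; floor; _/_; Positive; 1/_; _*_; *≤*)
open import Data.Rational.Properties as ℚP using (≤-refl; ≤-trans; ≤-reflexive; ≤-antisym)
open import Data.Nat.Coprimality using (Coprime)
open import Data.Nat.Divisibility using (∣1⇒≡1)
open import Data.Fin as Fin using (Fin)
open import Data.Fin.Subset using (Subset; _∈_; _∉_)
open import Data.Fin.Subset.Properties using (_∈?_)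
open import Data.Sum using (_⊎_; inj₁; inj₂)
open import Data.Product using (_×_; _,_; proj₁; proj₂; ∃-syntax)
open import Data.Empty using (⊥-elim)
open import Relation.Binary.PropositionalEquality
open import Relation.Nullary using (¬_; yes; no)

/?-*-inverse : ∀ p q → Positive q → (p /? q) * q ≡ p
/?-*-inverse p q@(mkℚ +[1+ _ ] _ _) _ = begin
  p * 1/ q * q   ≡⟨ ℚP.*-assoc p (1/ q) q ⟩
  p * (1/ q * q) ≡⟨ cong (p *_) (ℚP.*-inverseˡ q) ⟩
  p * 1ℚ         ≡⟨ ℚP.*-identityʳ p ⟩
  p              ∎
  where open ≡-Reasoning

/?-pos : ∀ p q → Positive p → Positive q → Positive (p /? q)
/?-pos p q@(mkℚ +[1+ _ ] _ _) p>0 _ = ℚP.pos*pos⇒pos p {{p>0}} (1/ q) {{ℚP.1/pos⇒pos q}}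

/?-identityʳ : ∀ p → p /? 1ℚ ≡ p
/?-identityʳ p = ℚP.*-identityʳ p

≤/?⇒*≤ : ∀ {a p} q → Positive q → a ℚ.≤ p /? q → a * q ℚ.≤ p
≤/?⇒*≤ {p = p} q q>0 a≤p/q =
  ≤-trans (ℚP.*-monoʳ-≤-nonNeg q {{ℚP.pos⇒nonNeg q {{q>0}}}} a≤p/q) (≤-reflexive (/?-*-inverse p q q>0))

*≤⇒≤/? : ∀ {a p} q → Positive q → a * q ℚ.≤ p → a ℚ.≤ p /? q
*≤⇒≤/? {p = p} q q>0 aq≤p =
  ℚP.*-cancelʳ-≤-pos q {{q>0}} (≤-trans aq≤p (≤-reflexive (sym (/?-*-inverse p q q>0))))

/?-swap-≤ : ∀ {p} a b → Positive a → Positive b → a ℚ.≤ p /? b → b ℚ.≤ p /? a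
/?-swap-≤ a b a>0 b>0 a≤p/b =
  *≤⇒≤/? a a>0 (≤-trans (≤-reflexive (ℚP.*-comm b a)) (≤/?⇒*≤ b b>0 a≤p/b))

/?-antimonoʳ-≤ : ∀ p a b → Positive p → Positive a → Positive b → a ℚ.≤ b → p /? b ℚ.≤ p /? a
/?-antimonoʳ-≤ p a b p>0 a>0 b>0 a≤b = *≤⇒≤/? a a>0 (begin
  p /? b * a ≤⟨ ℚP.*-monoˡ-≤-nonNeg (p /? b) {{ℚP.pos⇒nonNeg (p /? b) {{/?-pos p b p>0 b>0}}}} a≤b ⟩
  p /? b * b ≡⟨ /?-*-inverse p b b>0 ⟩
  p          ∎)
  where open ℚP.≤-Reasoning

/?-cancelʳ-≤ : ∀ p a b → Positive p → Positive a → Positive b → p /? b ℚ.≤ p /? a → a ℚ.≤ b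
/?-cancelʳ-≤ p a b p>0 a>0 b>0 p/b≤p/a =
  ℚP.*-cancelˡ-≤-pos (p /? b) {{/?-pos p b p>0 b>0}} (begin
    p /? b * a ≤⟨ ≤/?⇒*≤ a a>0 p/b≤p/a ⟩
    p          ≡⟨ /?-*-inverse p b b>0 ⟨
    p /? b * b ∎)
  where open ℚP.≤-Reasoning

coprime-1 : ∀ n → Coprime n 1
coprime-1 n (_ , d∣1) = ∣1⇒≡1 d∣1

i/1≡mkℚ : ∀ i → i / 1 ≡ mkℚ i 0 (coprime-1 ℤ.∣ i ∣)
i/1≡mkℚ (+ n)    = ℚP.normalize-coprime (coprime-1 n)
i/1≡mkℚ -[1+ n ] = cong ℚ.-_ (ℚP.normalize-coprime (coprime-1 (suc n)))

/1-mono-≤ : ∀ {i j} → i ℤ.≤ j → i / 1 ℚ.≤ j / 1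
/1-mono-≤ {i} {j} i≤j rewrite i/1≡mkℚ i | i/1≡mkℚ j =
  *≤* (subst₂ ℤ._≤_ (sym (ℤP.*-identityʳ i)) (sym (ℤP.*-identityʳ j)) i≤j)

/1-cancel-≤ : ∀ {i j} → i / 1 ℚ.≤ j / 1 → i ℤ.≤ j
/1-cancel-≤ {i} {j} i≤j rewrite i/1≡mkℚ i | i/1≡mkℚ j with i≤j
... | *≤* i*1≤j*1 = subst₂ ℤ._≤_ (ℤP.*-identityʳ i) (ℤP.*-identityʳ j) i*1≤j*1

+/1-pos : ∀ n → 1 ≤ n → Positive (+ n / 1)
+/1-pos (suc n) _ = ℚP.normalize-pos (suc n) 1

*≤⇒≤/ℕ : ∀ i n d .{{_ : ℕ.NonZero d}} → i ℤ.* + d ℤ.≤ n → i ℤ.≤ n ℤ./ℕ d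
*≤⇒≤/ℕ i n d i*d≤n = ℤP.≮⇒≥ λ n/d<i → ℤP.<-irrefl refl (ℤP.<-≤-trans (n<s[n/ℕd]*d n d) (begin
  ℤ.suc (n ℤ./ℕ d) ℤ.* + d ≤⟨ ℤP.*-monoʳ-≤-nonNeg (+ d) (ℤP.i<j⇒suc[i]≤j n/d<i) ⟩
  i ℤ.* + d                ≤⟨ i*d≤n ⟩
  n                        ∎))
  where open ℤP.≤-Reasoning

floor-greatest : ∀ i q → i / 1 ℚ.≤ q → i ℤ.≤ floor q
floor-greatest i q@(mkℚ n d _) i≤q with subst (ℚ._≤ q) (i/1≡mkℚ i) i≤q
... | *≤* i*d≤n*1 = subst (i ℤ.≤_) (sym (div-pos-is-/ℕ n (suc d)))
  (*≤⇒≤/ℕ i n (suc d) (ℤP.≤-trans i*d≤n*1 (ℤP.≤-reflexive (ℤP.*-identityʳ n))))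

floor-≤ : ∀ q → floor q / 1 ℚ.≤ q
floor-≤ q@(mkℚ n d _) rewrite i/1≡mkℚ (floor q) =
  *≤* (ℤP.≤-trans ([n/d]*d≤n n (+ suc d)) (ℤP.≤-reflexive (sym (ℤP.*-identityʳ n))))

floor-mono-≤ : ∀ {p q} → p ℚ.≤ q → floor p ℤ.≤ floor q
floor-mono-≤ {p} {q} p≤q = floor-greatest (floor p) q (≤-trans (floor-≤ p) p≤q)

floor-/?-nonNeg : ∀ x l → Positive x → Positive l → + 0 ℤ.≤ floor (x /? l)
floor-/?-nonNeg x l x>0 l>0 =
  floor-greatest +0 (x /? l) (ℚP.<⇒≤ (ℚP.positive⁻¹ (x /? l) {{/?-pos x l x>0 l>0}}))

Σℤ-mono-≤ : ∀ n {f g : Fin n → ℤ} → (∀ i → f i ℤ.≤ g i) → Σℤ n f ℤ.≤ Σℤ n g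
Σℤ-mono-≤ zero    f≤g = ℤP.≤-refl
Σℤ-mono-≤ (suc n) f≤g = ℤP.+-mono-≤ (f≤g Fin.zero) (Σℤ-mono-≤ n (λ i → f≤g (Fin.suc i)))

m-antimono-≤ : ∀ {n} (L : Fin n → ℚ) → (∀ i → Positive (L i)) →
               ∀ l l' → Positive l → Positive l' → l ℚ.≤ l' → m L l' ℤ.≤ m L l
m-antimono-≤ {n} L L>0 l l' l>0 l'>0 l≤l' =
  Σℤ-mono-≤ n λ i → floor-mono-≤ (/?-antimonoʳ-≤ (L i) l l' (L>0 i) l>0 l'>0 l≤l')

feasible-downward : ∀ {n} (L : Fin n → ℚ) k → (∀ i → Positive (L i)) →
                    ∀ {l} l' → Feasible L k l → Positive l' → l' ℚ.≤ l → Feasible L k l'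
feasible-downward L k L>0 {l} l' (l>0 , k≤m[l]) l'>0 l'≤l =
  l'>0 , ℤP.≤-trans k≤m[l] (m-antimono-≤ L L>0 l' l l'>0 l>0 l'≤l)

argmin : ∀ {n} (g : Fin (suc n) → ℚ) → ∃[ i ] (∀ j → g i ℚ.≤ g j)
argmin {zero}  g = Fin.zero , λ { Fin.zero → ≤-refl }
argmin {suc n} g with argmin (λ i → g (Fin.suc i))
... | i , gi-min with ℚP.≤-total (g Fin.zero) (g (Fin.suc i))
...   | inj₁ g0≤gi = Fin.zero , λ { Fin.zero → ≤-refl ; (Fin.suc j) → ≤-trans g0≤gi (gi-min j) }
...   | inj₂ gi≤g0 = Fin.suc i , λ { Fin.zero → gi≤g0 ; (Fin.suc j) → gi-min j }

p<p+1 : ∀ p → p ℚ.< p ℚ.+ 1ℚ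
p<p+1 p = subst (ℚ._< p ℚ.+ 1ℚ) (ℚP.+-identityʳ p) (ℚP.+-monoʳ-< p (ℚP.positive⁻¹ 1ℚ))

-- The largest l with ⌊x / l⌋ ≥ i, when i > 0; for i ≤ 0 every l qualifies and the
-- supplied bound `above` is returned instead.
breakpoint : ℚ → ℚ → ℤ → ℚ
breakpoint x above +[1+ j ] = x /ℕ suc j
breakpoint x above +0       = above
breakpoint x above -[1+ _ ] = above

breakpoint-pos : ∀ {x above} → Positive x → Positive above → ∀ i → Positive (breakpoint x above i)
breakpoint-pos {x} x>0 _       +[1+ j ] = /?-pos x (+ suc j / 1) x>0 (+/1-pos (suc j) (s≤s z≤n))
breakpoint-pos     _ above>0 +0       = above>0
breakpoint-pos     _ above>0 -[1+ _ ] = above>0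

≤-breakpoint : ∀ {x above} l → Positive l → l ℚ.≤ above →
               ∀ i → i / 1 ℚ.≤ x /? l → l ℚ.≤ breakpoint x above i
≤-breakpoint l l>0 _       +[1+ j ] j≤x/l = /?-swap-≤ (+ suc j / 1) l (+/1-pos (suc j) (s≤s z≤n)) l>0 j≤x/l
≤-breakpoint l _   l≤above +0       _     = l≤above
≤-breakpoint l _   l≤above -[1+ _ ] _     = l≤above

floor-breakpoint : ∀ {x above} l → Positive x → Positive l →
                   ∀ i → l ℚ.≤ breakpoint x above i → i ℤ.≤ floor (x /? l)
floor-breakpoint {x} l _ l>0 +[1+ j ] l≤x/j =
  floor-greatest +[1+ j ] (x /? l) (/?-swap-≤ l (+ suc j / 1) l>0 (+/1-pos (suc j) (s≤s z≤n)) l≤x/j)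
floor-breakpoint {x} l x>0 l>0 +0       _ = floor-/?-nonNeg x l x>0 l>0
floor-breakpoint {x} l x>0 l>0 -[1+ _ ] _ = ℤP.≤-trans ℤ.-≤+ (floor-/?-nonNeg x l x>0 l>0)

breakpoint-fixed : ∀ {x} l i → breakpoint x (l ℚ.+ 1ℚ) i ≡ l → ∃[ j ] l ≡ x /ℕ suc j
breakpoint-fixed l +[1+ j ] x/j≡l  = j , sym x/j≡l
breakpoint-fixed l +0       l+1≡l  = ⊥-elim (ℚP.<-irrefl (sym l+1≡l) (p<p+1 l))
breakpoint-fixed l -[1+ _ ] l+1≡l  = ⊥-elim (ℚP.<-irrefl (sym l+1≡l) (p<p+1 l))

optimum-is-quotient : ∀ {n} (L : Fin n → ℚ) k → (∀ i → Positive (L i)) → 1 ≤ k →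
                      ∀ l → IsOptimal L k l → ∃[ i ] ∃[ j ] l ≡ L i /ℕ suc j
optimum-is-quotient {zero} L k _ 1≤k l ((_ , k≤0) , _) = ⊥-elim (ℕP.≤⇒≯ (ℤP.drop‿+≤+ k≤0) 1≤k)
optimum-is-quotient {suc n} L k L>0 _ l ((l>0 , k≤m[l]) , l-max) =
  i , breakpoint-fixed l (floor (L i /? l)) (≤-antisym (l-max l' l'-feasible) l≤l')
  where
    bp : Fin (suc n) → ℚ
    bp i = breakpoint (L i) (l ℚ.+ 1ℚ) (floor (L i /? l))

    i = proj₁ (argmin bp)
    l' = bp i

    l'>0 : Positive l'
    l'>0 = breakpoint-pos (L>0 i) (ℚP.pos+pos⇒pos l {{l>0}} 1ℚ) (floor (L i /? l))

    l≤l' : l ℚ.≤ l'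
    l≤l' = ≤-breakpoint l l>0 (ℚP.<⇒≤ (p<p+1 l)) (floor (L i /? l)) (floor-≤ (L i /? l))

    m[l]≤m[l'] : m L l ℤ.≤ m L l'
    m[l]≤m[l'] = Σℤ-mono-≤ (suc n) λ j →
      floor-breakpoint l' (L>0 j) l'>0 (floor (L j /? l)) (proj₂ (argmin bp) j)

    l'-feasible : Feasible L k l'
    l'-feasible = l'>0 , ℤP.≤-trans k≤m[l] m[l]≤m[l']

/ℕ-antimono-≤ : ∀ x a b → Positive x → 1 ≤ a → a ≤ b → x /ℕ b ℚ.≤ x /ℕ a
/ℕ-antimono-≤ x a b x>0 1≤a a≤b = /?-antimonoʳ-≤ x (+ a / 1) (+ b / 1) x>0
  (+/1-pos a 1≤a) (+/1-pos b (ℕP.≤-trans 1≤a a≤b)) (/1-mono-≤ (ℤ.+≤+ a≤b))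

/ℕ-cancel-≤ : ∀ x a b → Positive x → 1 ≤ a → 1 ≤ b → x /ℕ b ℚ.≤ x /ℕ a → a ≤ b
/ℕ-cancel-≤ x a b x>0 1≤a 1≤b x/b≤x/a = ℤP.drop‿+≤+ (/1-cancel-≤
  (/?-cancelʳ-≤ x (+ a / 1) (+ b / 1) x>0 (+/1-pos a 1≤a) (+/1-pos b 1≤b) x/b≤x/a))

/ℕ-≤ : ∀ x a → Positive x → 1 ≤ a → x /ℕ a ℚ.≤ x
/ℕ-≤ x a x>0 1≤a = subst (x /ℕ a ℚ.≤_) (/?-identityʳ x) (/ℕ-antimono-≤ x 1 a x>0 ℕP.≤-refl 1≤a)

predecessor-infeasible⇒≤ : ∀ {n} (L : Fin n → ℚ) k → (∀ i → Positive (L i)) →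
  ∀ {l} i j f → Feasible L k l → l ≡ L i /ℕ suc j →
  ¬ Feasible L k (L i /ℕ (f ∸ 1)) → f ≤ suc j
predecessor-infeasible⇒≤ L k L>0 i j f l-feasible l≡L/j infeasible with f ℕ.≤? suc j
... | yes f≤j = f≤j
... | no  f≰j = ⊥-elim (infeasible (feasible-downward L k L>0 (L i /ℕ (f ∸ 1)) l-feasible
        (/?-pos (L i) (+ (f ∸ 1) / 1) (L>0 i) (+/1-pos (f ∸ 1) (ℕP.≤-trans (s≤s z≤n) j<f∸1)))
        (≤-trans (/ℕ-antimono-≤ (L i) (suc j) (f ∸ 1) (L>0 i) (s≤s z≤n) j<f∸1) (≤-reflexive (sym l≡L/j)))))
  where
    j<f∸1 : suc j ≤ f ∸ 1
    j<f∸1 = ℕP.∸-monoˡ-≤ 1 (ℕP.≰⇒> f≰j)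

lemma4 : (n : ℕ) (L : Fin n → ℚ) (k : ℕ) → (∀ i → Positive (L i)) → 1 ≤ k →
    (I : Subset n) (fl fu : Fin n → ℕ) →
    (∀ i → i ∈ I → 1 ≤ fl i) →
    (∀ i → i ∈ I → 1 ≤ fu i) →
    (∀ i → i ∈ I → fl i ≡ 1 ⊎ ¬ Feasible L k (L i /ℕ (fl i ∸ 1))) →
    (∀ i → i ∈ I → Feasible L k (L i /ℕ fu i)) →
    (lstar : ℚ) → IsOptimal L k lstar →
    (∀ i → i ∉ I → Feasible L k (L i) × L i ≢ lstar) →
    InCandidates L I fl fu lstar
lemma4 n L k L>0 1≤k I fl fu _ 1≤fu fl-tight fu-feasible l* (l*-feasible , l*-max) outside
  with optimum-is-quotient L k L>0 1≤k l* (l*-feasible , l*-max)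
... | i , j , l*≡L/j with i ∈? I
...   | no i∉I = ⊥-elim (proj₂ (outside i i∉I) (≤-antisym
          (l*-max (L i) (proj₁ (outside i i∉I)))
          (≤-trans (≤-reflexive l*≡L/j) (/ℕ-≤ (L i) (suc j) (L>0 i) (s≤s z≤n)))))
...   | yes i∈I = i , suc j , i∈I , fl≤j , j≤fu , l*≡L/j
  where
    fl≤j : fl i ≤ suc j
    fl≤j with fl-tight i i∈I
    ... | inj₁ fl≡1      = subst (_≤ suc j) (sym fl≡1) (s≤s z≤n)
    ... | inj₂ infeasible = predecessor-infeasible⇒≤ L k L>0 i j (fl i) l*-feasible l*≡L/j infeasible

    j≤fu : suc j ≤ fu i
    j≤fu = /ℕ-cancel-≤ (L i) (suc j) (fu i) (L>0 i) (s≤s z≤n) (1≤fu i i∈I)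
      (subst (L i /ℕ fu i ℚ.≤_) l*≡L/j (l*-max (L i /ℕ fu i) (fu-feasible i i∈I)))
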